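{- Let $n\ge 3$ be an even integer, let $\mathcal{F}$ be a 1-factorisation of $Circ(2n,\{1,2\})$, and let $Y\in\mathcal{F}$ be a 1-factor every edge of which is a 1-edge $e$ whose configuration $C_e$ is a 2-configuration. Then for any two distinct $X,Z\in\mathcal{F}\setminus\{Y\}$, every cycle of $X\cup Z$ contains either zero or exactly two 1-edges.
   Context: For a positive integer $N$ and $D\subseteq\{1,\dots,\lfloor N/2\rfloor\}$, the circulant graph $Circ(N,D)$ has vertex set $\mathbb{Z}_N$, with $u,v$ adjacent iff $u-v\equiv \pm d \pmod N$ for some $d\in D$. A 1-factor is a 1-regular spanning subgraph; a 1-factorisation is a partition of the edge set into 1-factors; regard a 1-factorisation as an edge colouring in which each 1-factor is a colour class. In $Circ(2n,\{1,2\})$ (arithmetic mod $2n$), a 1-edge is an edge $\{v,v+1\}$ and a 2-edge is an edge $\{v,v+2\}$. The configuration of the 1-edge $e=\{v,v+1\}$ is $C_e=\{\{v-1,v+1\},\{v,v+1\},\{v,v+2\}\}$; it is a $k$-configuration if exactly $k$ distinct colours occur on its three edges. -}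

module Defs where

open import Data.Nat using (ℕ; zero; suc; _+_; _≤_)
open import Data.Nat.DivMod using (_mod_)
open import Data.Fin using (Fin; toℕ)
open import Data.Product using (Σ; _×_; _,_; ∃)
open import Data.Sum using (_⊎_)
open import Data.List using (List; length; filter; allFin)
open import Relation.Binary.PropositionalEquality using (_≡_; _≢_)
open import Relation.Nullary using (Dec; yes; no; ¬_)
open import Function.Definitions using (Injective)
import Data.Nat as ℕ

-- Vertices of Circ(N, {1,2}) are Fin N (i.e. Z_N).
-- cyclic successor v ↦ v + 1 (mod N) and predecessor v ↦ v - 1 (mod N)
sucMod : ∀ {N} → Fin N → Fin N
sucMod {suc k} i = (suc (toℕ i)) mod (suc k)

predMod : ∀ {N} → Fin N → Fin N
predMod {suc k} i = (toℕ i + k) mod (suc k)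

data Kind : Set where
  one two : Kind

-- An edge of Circ(N,{1,2}) is given by its "base" vertex v and its kind;
-- (v , one) is {v, v+1}, (v , two) is {v, v+2}.  For N ≥ 5 this is a
-- bijective description of the edge set.
Edge : ℕ → Set
Edge N = Fin N × Kind

base : ∀ {N} → Edge N → Fin N
base (v , _) = v

kind : ∀ {N} → Edge N → Kind
kind (_ , k) = k

top : ∀ {N} → Edge N → Fin N
top (v , one) = sucMod v
top (v , two) = sucMod (sucMod v)

Incident : ∀ {N} → Edge N → Fin N → Set
Incident e u = (u ≡ base e) ⊎ (u ≡ top e)

Joins : ∀ {N} → Edge N → Fin N → Fin N → Set
Joins e u w = (u ≡ base e × w ≡ top e) ⊎ (w ≡ base e × u ≡ top e)

Colouring : ℕ → Set
Colouring N = Edge N → ℕ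

Used : ∀ {N} → Colouring N → ℕ → Set
Used c i = ∃ λ e → c e ≡ i

IsOneFactor : ∀ {N} → (Edge N → Set) → Set
IsOneFactor {N} S =
  ∀ (u : Fin N) → ∃ λ e → S e × Incident e u ×
    (∀ e′ → S e′ → Incident e′ u → e′ ≡ e)

-- a 1-factorisation viewed as an edge colouring: each colour class is a 1-factor
IsOneFactorisation : ∀ {N} → Colouring N → Set
IsOneFactorisation c = ∀ i → Used c i → IsOneFactor (λ e → c e ≡ i)

distinct3 : ℕ → ℕ → ℕ → ℕ
distinct3 a b d with a ℕ.≟ b | b ℕ.≟ d | a ℕ.≟ d
... | yes _ | yes _ | _     = 1
... | yes _ | no _  | _     = 2
... | no _  | yes _ | _     = 2
... | no _  | no _  | yes _ = 2
... | no _  | no _  | no _  = 3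

-- configuration of the 1-edge e = {v, v+1}:
-- C_e = {{v-1, v+1}, {v, v+1}, {v, v+2}}; it is a k-configuration when
-- exactly k distinct colours occur on these three edges.
IsKConfiguration : ∀ {N} → Colouring N → ℕ → Fin N → Set
IsKConfiguration c k v =
  distinct3 (c (predMod v , two)) (c (v , one)) (c (v , two)) ≡ k

isOne : Kind → Set
isOne one = Data.Unit.⊤ where import Data.Unit
isOne two = Data.Empty.⊥ where import Data.Empty

isOne? : (k : Kind) → Dec (isOne k)
isOne? one = yes _
isOne? two = no λ ()

record CycleIn {N} (c : Colouring N) (x z : ℕ) : Set where
  field
    m      : ℕ
    m≥3    : 3 ≤ m
    vs     : Fin m → Fin N
    vs-inj : Injective _≡_ _≡_ vs
    es     : Fin m → Edge N
    es-joins  : ∀ i → Joins (es i) (vs i) (vs (sucMod i))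
    es-colour : ∀ i → (c (es i) ≡ x) ⊎ (c (es i) ≡ z)

numOneEdges : ∀ {N} {c : Colouring N} {x z : ℕ} → CycleIn c x z → ℕ
numOneEdges C = length (filter (λ i → isOne? (kind (es i))) (allFin m))
  where open CycleIn C

-- Since Y consists of 1-edges, it alternates around the Hamilton cycle 0, 1, …, 2n − 1,
-- so every vertex v has exactly one 1-neighbour  mate v  with {v, mate v} ∉ Y.  The map
-- mate is a fixed-point-free involution, and the 2-configuration condition makes it
-- colour-preserving on all edges not in Y: it fixes each 1-edge outside Y and exchanges the
-- two 2-edges of each configuration, which carry the same colour.  The 1-edges of a cycle C
-- of X ∪ Z are exactly its edges {v, mate v}.  If C has one, then mate maps C onto itself,
-- reversing it about that edge, because in X ∪ Z a walk that does not backtrack is determined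
-- by its first two vertices.  A reflection of a cycle of length M that fixes no vertex forces
-- M to be even and fixes exactly two (opposite) edges.
module Submission where

open import Defs
open import Data.Bool using (if_then_else_)
open import Data.Empty using (⊥; ⊥-elim)
open import Data.Fin using (Fin; zero; suc; toℕ)
open import Data.Fin.Properties using (toℕ-injective; toℕ-fromℕ<; toℕ<n; any?)
import Data.Fin.Properties as Fin
open import Data.List using (length; filter; tabulate; allFin)
open import Data.Nat using (ℕ; zero; suc; _+_; _*_; _∸_; _≤_; _<_; _<?_; z≤n; s≤s; z<s; NonZero)
open import Data.Nat.DivMod
open import Data.Nat.Divisibility using (_∣_)
open import Data.Nat.Properties
open import Data.Nat.Tactic.RingSolver using (solve-∀)
open import Data.Product using (_×_; _,_; ∃; proj₁; proj₂)
open import Data.Sum using (_⊎_; inj₁; inj₂; [_,_]′)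
import Data.Sum as Sum
open import Function using (_∘_; id)
open import Function.Definitions using (Injective)
open import Relation.Binary.Definitions using (tri<; tri≈; tri>)
open import Relation.Binary.PropositionalEquality
open import Relation.Nullary using (¬_; Dec; yes; no; does)
open import Relation.Unary using (Decidable)

open ≡-Reasoning

count : ∀ {n} {P : Fin n → Set} → Decidable P → ℕ
count {zero}  P? = 0
count {suc n} P? = (if does (P? zero) then 1 else 0) + count (P? ∘ suc)

length-filter-tabulate : ∀ {a} {A : Set a} {P : A → Set} (P? : Decidable P) {n} (f : Fin n → A) →
  length (filter P? (tabulate f)) ≡ count (P? ∘ f)
length-filter-tabulate P? {zero}  f = refl
length-filter-tabulate P? {suc n} f with P? (f zero)
... | yes _ = cong suc (length-filter-tabulate P? (f ∘ suc))
... | no  _ = length-filter-tabulate P? (f ∘ suc)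

count-none : ∀ {n} {P : Fin n → Set} (P? : Decidable P) → (∀ j → ¬ P j) → count P? ≡ 0
count-none {zero}  P? none = refl
count-none {suc n} P? none with P? zero
... | yes p0 = ⊥-elim (none zero p0)
... | no  _  = count-none (P? ∘ suc) (none ∘ suc)

count-single : ∀ {n} {P : Fin n → Set} (P? : Decidable P) {a} →
  P a → (∀ j → P j → j ≡ a) → count P? ≡ 1
count-single {suc n} P? {zero} pa only with P? zero
... | yes _   = cong suc (count-none (P? ∘ suc) (λ j pj → Fin.0≢1+n (sym (only (suc j) pj))))
... | no  ¬pa = ⊥-elim (¬pa pa)
count-single {suc n} P? {suc a} pa only with P? zero
... | yes p0 = ⊥-elim (Fin.0≢1+n (only zero p0))
... | no  _  = count-single (P? ∘ suc) pa (λ j pj → Fin.suc-injective (only (suc j) pj))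

count-pair : ∀ {n} {P : Fin n → Set} (P? : Decidable P) {a b} →
  P a → P b → a ≢ b → (∀ j → P j → j ≡ a ⊎ j ≡ b) → count P? ≡ 2
count-pair {suc n} P? {zero} {zero} _ _ a≢b _ = ⊥-elim (a≢b refl)
count-pair {suc n} P? {zero} {suc b} pa pb _ only with P? zero
... | yes _   = cong suc (count-single (P? ∘ suc) pb (λ j pj →
                  [ ⊥-elim ∘ Fin.0≢1+n ∘ sym , Fin.suc-injective ]′ (only (suc j) pj)))
... | no  ¬pa = ⊥-elim (¬pa pa)
count-pair {suc n} P? {suc a} {zero} pa pb a≢b only =
  count-pair P? pb pa (a≢b ∘ sym) (λ j pj → Sum.swap (only j pj))
count-pair {suc n} P? {suc a} {suc b} pa pb a≢b only with P? zero
... | yes p0 = ⊥-elim ([ Fin.0≢1+n , Fin.0≢1+n ]′ (only zero p0))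
... | no  _  = count-pair (P? ∘ suc) pa pb (a≢b ∘ cong suc)
                 (λ j pj → Sum.map Fin.suc-injective Fin.suc-injective (only (suc j) pj))

[m%o+n]%o≡[m+n]%o : ∀ m n o .{{_ : NonZero o}} → (m % o + n) % o ≡ (m + n) % o
[m%o+n]%o≡[m+n]%o m n o = begin
  (m % o + n) % o          ≡⟨ %-distribˡ-+ (m % o) n o ⟩
  (m % o % o + n % o) % o  ≡⟨ cong (λ t → (t + n % o) % o) (m%n%n≡m%n m o) ⟩
  (m % o + n % o) % o      ≡⟨ %-distribˡ-+ m n o ⟨
  (m + n) % o              ∎

[m+n%o]%o≡[m+n]%o : ∀ m n o .{{_ : NonZero o}} → (m + n % o) % o ≡ (m + n) % o
[m+n%o]%o≡[m+n]%o m n o = begin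
  (m + n % o) % o  ≡⟨ cong (_% o) (+-comm m (n % o)) ⟩
  (n % o + m) % o  ≡⟨ [m%o+n]%o≡[m+n]%o n m o ⟩
  (n + m) % o      ≡⟨ cong (_% o) (+-comm n m) ⟩
  (m + n) % o      ∎

suc-%-cong : ∀ m n {o} .{{_ : NonZero o}} → m % o ≡ n % o → suc m % o ≡ suc n % o
suc-%-cong m n {o} eq = begin
  suc m % o          ≡⟨ [m+n%o]%o≡[m+n]%o 1 m o ⟨
  suc (m % o) % o    ≡⟨ cong (λ t → suc t % o) eq ⟩
  suc (n % o) % o    ≡⟨ [m+n%o]%o≡[m+n]%o 1 n o ⟩
  suc n % o          ∎

[m+n]%o≢n%o : ∀ {m} n {o} .{{_ : NonZero o}} → 0 < m → m < o → (m + n) % o ≢ n % o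
[m+n]%o≢n%o {m} n {o} 0<m m<o eq = byCases (m + n % o <? o)
  where
  reduced : (m + n % o) % o ≡ n % o
  reduced = trans ([m+n%o]%o≡[m+n]%o m n o) eq

  byCases : Dec (m + n % o < o) → ⊥
  byCases (yes small) = <⇒≢ 0<m (sym (+-cancelʳ-≡ (n % o) m 0 (begin
    m + n % o        ≡⟨ m<n⇒m%n≡m small ⟨
    (m + n % o) % o  ≡⟨ reduced ⟩
    n % o            ∎)))
  byCases (no large) = <⇒≢ m<o (+-cancelʳ-≡ (n % o) m o (begin
    m + n % o              ≡⟨ m∸n+n≡m o≤ ⟨
    (m + n % o ∸ o) + o    ≡⟨ cong (_+ o) wrapped ⟩
    n % o + o              ≡⟨ +-comm (n % o) o ⟩
    o + n % o              ∎))
    where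
    o≤ : o ≤ m + n % o
    o≤ = ≮⇒≥ large
    small′ : m + n % o ∸ o < o
    small′ = m<n+o⇒m∸n<o (m + n % o) o (+-mono-< m<o (m%n<n n o))
    wrapped : m + n % o ∸ o ≡ n % o
    wrapped = begin
      m + n % o ∸ o          ≡⟨ m<n⇒m%n≡m small′ ⟨
      (m + n % o ∸ o) % o    ≡⟨ m≤n⇒[n∸m]%m≡n%m o≤ ⟩
      (m + n % o) % o        ≡⟨ reduced ⟩
      n % o                  ∎

[i+m]%o≢[i+n]%o : ∀ i {m n o} .{{_ : NonZero o}} → m < n → n < o → (i + m) % o ≢ (i + n) % o
[i+m]%o≢[i+n]%o i {m} {n} {o} m<n n<o eq =
  [m+n]%o≢n%o (i + m) (m<n⇒0<n∸m m<n) (≤-<-trans (m∸n≤m n m) n<o)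
    (trans (cong (_% o) shift) (sym eq))
  where
  shift : n ∸ m + (i + m) ≡ i + n
  shift = begin
    n ∸ m + (i + m)  ≡⟨ cong (n ∸ m +_) (+-comm i m) ⟩
    n ∸ m + (m + i)  ≡⟨ +-assoc (n ∸ m) m i ⟨
    n ∸ m + m + i    ≡⟨ cong (_+ i) (m∸n+n≡m (<⇒≤ m<n)) ⟩
    n + i            ≡⟨ +-comm n i ⟩
    i + n            ∎

[i+m]%o≡[i+n]%o⇒m≡n : ∀ i {m n o} .{{_ : NonZero o}} →
  m < o → n < o → (i + m) % o ≡ (i + n) % o → m ≡ n
[i+m]%o≡[i+n]%o⇒m≡n i {m} {n} m<o n<o eq with <-cmp m n
... | tri≈ _ m≡n _ = m≡n
... | tri< m<n _ _ = ⊥-elim ([i+m]%o≢[i+n]%o i m<n n<o eq)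
... | tri> _ _ n<m = ⊥-elim ([i+m]%o≢[i+n]%o i n<m m<o (sym eq))

%-offset : ∀ {o} .{{_ : NonZero o}} i n → i ≤ o → ∃ λ k → k < o × (i + k) % o ≡ n % o
%-offset {o} i n i≤o = (o ∸ i + n) % o , m%n<n (o ∸ i + n) o , (begin
  (i + (o ∸ i + n) % o) % o  ≡⟨ [m+n%o]%o≡[m+n]%o i (o ∸ i + n) o ⟩
  (i + (o ∸ i + n)) % o      ≡⟨ cong (_% o) (+-assoc i (o ∸ i) n) ⟨
  (i + (o ∸ i) + n) % o      ≡⟨ cong (λ t → (t + n) % o) (m+[n∸m]≡n i≤o) ⟩
  (o + n) % o                ≡⟨ cong (_% o) (+-comm o n) ⟩
  (n + o) % o                ≡⟨ [m+n]%n≡m%n n o ⟩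
  n % o                      ∎)

even⊎odd : ∀ n → (∃ λ h → n ≡ h + h) ⊎ (∃ λ h → n ≡ suc (h + h))
even⊎odd zero = inj₁ (0 , refl)
even⊎odd (suc n) with even⊎odd n
... | inj₁ (h , n≡h+h)     = inj₂ (h , cong suc n≡h+h)
... | inj₂ (h , n≡1+h+h) = inj₁ (suc h , cong suc (trans n≡1+h+h (sym (+-suc h h))))

+-double-injective : ∀ {m n} → m + m ≡ n + n → m ≡ n
+-double-injective {zero}  {zero}  _  = refl
+-double-injective {suc m} {suc n} eq = cong suc (+-double-injective (suc-injective (begin
  suc (m + m)  ≡⟨ +-suc m m ⟨
  m + suc m    ≡⟨ suc-injective eq ⟩
  n + suc n    ≡⟨ +-suc n n ⟩
  suc (n + n)  ∎)))

module _ {K : ℕ} where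

  private
    N : ℕ
    N = suc K

  toℕ-sucMod : ∀ (v : Fin N) → toℕ (sucMod v) ≡ suc (toℕ v) % N
  toℕ-sucMod v = toℕ-fromℕ< _

  toℕ-predMod : ∀ (v : Fin N) → toℕ (predMod v) ≡ (toℕ v + K) % N
  toℕ-predMod v = toℕ-fromℕ< _

  toℕ%N≡toℕ : ∀ (v : Fin N) → toℕ v % N ≡ toℕ v
  toℕ%N≡toℕ v = m<n⇒m%n≡m (toℕ<n v)

  predMod-sucMod : ∀ (v : Fin N) → predMod (sucMod v) ≡ v
  predMod-sucMod v = toℕ-injective (begin
    toℕ (predMod (sucMod v))    ≡⟨ toℕ-predMod (sucMod v) ⟩
    (toℕ (sucMod v) + K) % N    ≡⟨ cong (λ t → (t + K) % N) (toℕ-sucMod v) ⟩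
    (suc (toℕ v) % N + K) % N   ≡⟨ [m%o+n]%o≡[m+n]%o (suc (toℕ v)) K N ⟩
    suc (toℕ v + K) % N         ≡⟨ cong (_% N) (+-suc (toℕ v) K) ⟨
    (toℕ v + N) % N             ≡⟨ [m+n]%n≡m%n (toℕ v) N ⟩
    toℕ v % N                   ≡⟨ toℕ%N≡toℕ v ⟩
    toℕ v                       ∎)

  sucMod-predMod : ∀ (v : Fin N) → sucMod (predMod v) ≡ v
  sucMod-predMod v = toℕ-injective (begin
    toℕ (sucMod (predMod v))    ≡⟨ toℕ-sucMod (predMod v) ⟩
    suc (toℕ (predMod v)) % N   ≡⟨ cong (λ t → suc t % N) (toℕ-predMod v) ⟩
    suc ((toℕ v + K) % N) % N   ≡⟨ [m+n%o]%o≡[m+n]%o 1 (toℕ v + K) N ⟩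
    suc (toℕ v + K) % N         ≡⟨ cong (_% N) (+-suc (toℕ v) K) ⟨
    (toℕ v + N) % N             ≡⟨ [m+n]%n≡m%n (toℕ v) N ⟩
    toℕ v % N                   ≡⟨ toℕ%N≡toℕ v ⟩
    toℕ v                       ∎)

  sucMod-injective : ∀ {u v : Fin N} → sucMod u ≡ sucMod v → u ≡ v
  sucMod-injective {u} {v} eq = begin
    u                    ≡⟨ predMod-sucMod u ⟨
    predMod (sucMod u)   ≡⟨ cong predMod eq ⟩
    predMod (sucMod v)   ≡⟨ predMod-sucMod v ⟩
    v                    ∎

  private
    toℕ-sucMod-shift : ∀ k t (w : Fin N) →
      toℕ w ≡ (k + t) % N → toℕ (sucMod w) ≡ (suc k + t) % N
    toℕ-sucMod-shift k t w eq =
      trans (toℕ-sucMod w) (trans (cong (λ u → suc u % N) eq) ([m+n%o]%o≡[m+n]%o 1 (k + t) N))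

    toℕ-sucMod¹ : ∀ (v : Fin N) → toℕ (sucMod v) ≡ (1 + toℕ v) % N
    toℕ-sucMod¹ v = toℕ-sucMod-shift 0 (toℕ v) v (sym (toℕ%N≡toℕ v))

    toℕ-sucMod² : ∀ (v : Fin N) → toℕ (sucMod (sucMod v)) ≡ (2 + toℕ v) % N
    toℕ-sucMod² v = toℕ-sucMod-shift 1 (toℕ v) (sucMod v) (toℕ-sucMod¹ v)

    toℕ-sucMod³ : ∀ (v : Fin N) → toℕ (sucMod (sucMod (sucMod v))) ≡ (3 + toℕ v) % N
    toℕ-sucMod³ v = toℕ-sucMod-shift 2 (toℕ v) (sucMod (sucMod v)) (toℕ-sucMod² v)

    shifted-≢ : ∀ k {w v : Fin N} → 0 < k → k ≤ K → toℕ w ≡ (k + toℕ v) % N → w ≢ v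
    shifted-≢ k {v = v} 0<k k≤K eq refl =
      [m+n]%o≢n%o (toℕ v) 0<k (s≤s k≤K) (trans (sym eq) (sym (toℕ%N≡toℕ v)))

  sucMod-≢ : 1 ≤ K → ∀ (v : Fin N) → sucMod v ≢ v
  sucMod-≢ 1≤K v = shifted-≢ 1 z<s 1≤K (toℕ-sucMod¹ v)

  sucMod²-≢ : 2 ≤ K → ∀ (v : Fin N) → sucMod (sucMod v) ≢ v
  sucMod²-≢ 2≤K v = shifted-≢ 2 z<s 2≤K (toℕ-sucMod² v)

  sucMod³-≢ : 3 ≤ K → ∀ (v : Fin N) → sucMod (sucMod (sucMod v)) ≢ v
  sucMod³-≢ 3≤K v = shifted-≢ 3 z<s 3≤K (toℕ-sucMod³ v)

  predMod-≢ : 1 ≤ K → ∀ (v : Fin N) → predMod v ≢ v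
  predMod-≢ 1≤K v eq = sucMod-≢ 1≤K v (trans (cong sucMod (sym eq)) (sucMod-predMod v))

-- Edges and 1-factorisations of Circ(N, {1, 2})

Joins-sym : ∀ {N} (e : Edge N) {u w} → Joins e u w → Joins e w u
Joins-sym e (inj₁ (u≡ , w≡)) = inj₂ (u≡ , w≡)
Joins-sym e (inj₂ (w≡ , u≡)) = inj₁ (w≡ , u≡)

Joins⇒Incident : ∀ {N} (e : Edge N) {u w} → Joins e u w → Incident e u
Joins⇒Incident e (inj₁ (u≡ , _)) = inj₁ u≡
Joins⇒Incident e (inj₂ (_ , u≡)) = inj₂ u≡

base≢top : ∀ {K} → 2 ≤ K → (e : Edge (suc K)) → base e ≢ top e
base≢top 2≤K (a , one) eq = sucMod-≢ (≤-trans (s≤s z≤n) 2≤K) a (sym eq)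
base≢top 2≤K (a , two) eq = sucMod²-≢ 2≤K a (sym eq)

Joins-functional : ∀ {K} → 2 ≤ K → (e : Edge (suc K)) {u t w : Fin (suc K)} →
  Joins e u t → Joins e u w → t ≡ w
Joins-functional 2≤K e (inj₁ (_ , t≡)) (inj₁ (_ , w≡)) = trans t≡ (sym w≡)
Joins-functional 2≤K e (inj₁ (u≡ , _)) (inj₂ (_ , u≡′)) =
  ⊥-elim (base≢top 2≤K e (trans (sym u≡) u≡′))
Joins-functional 2≤K e (inj₂ (_ , u≡)) (inj₁ (u≡′ , _)) =
  ⊥-elim (base≢top 2≤K e (trans (sym u≡′) u≡))
Joins-functional 2≤K e (inj₂ (t≡ , _)) (inj₂ (w≡ , _)) = trans t≡ (sym w≡)

isOne⇒≡one : ∀ {k} → isOne k → k ≡ one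
isOne⇒≡one {one} _ = refl

≡one⇒isOne : ∀ {k} → k ≡ one → isOne k
≡one⇒isOne refl = _

distinct3≡2⇒a≡d : ∀ a b d → distinct3 a b d ≡ 2 → a ≢ b → d ≢ b → a ≡ d
distinct3≡2⇒a≡d a b d eq a≢b d≢b with a ≟ b | b ≟ d | a ≟ d
... | yes a≡b | _       | _       = ⊥-elim (a≢b a≡b)
... | no _    | yes b≡d | _       = ⊥-elim (d≢b (sym b≡d))
... | no _    | no _    | yes a≡d = a≡d
... | no _    | no _    | no _    = ⊥-elim (3≢2 eq)
  where
  3≢2 : 3 ≢ 2
  3≢2 ()

module OneFactorisation {K : ℕ} (2≤K : 2 ≤ K) (c : Colouring (suc K)) (fac : IsOneFactorisation c)
  where

  private
    Vertex : Set
    Vertex = Fin (suc K)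

  same-colour-at : ∀ e e′ {u : Vertex} → c e ≡ c e′ → Incident e u → Incident e′ u → e ≡ e′
  same-colour-at e e′ {u} eq inc inc′ with fac (c e) (e , refl) u
  ... | _ , _ , _ , unique = trans (unique e refl inc) (sym (unique e′ (sym eq) inc′))

  same-colour-Joins : ∀ e e′ {u t w : Vertex} → c e ≡ c e′ → Joins e u t → Joins e′ u w → t ≡ w
  same-colour-Joins e e′ eq j j′
    with same-colour-at e e′ eq (Joins⇒Incident e j) (Joins⇒Incident e′ j′)
  ... | refl = Joins-functional 2≤K e j j′

  InColours : ℕ → ℕ → Edge (suc K) → Set
  InColours x z e = c e ≡ x ⊎ c e ≡ z

  private
    pair-pigeonhole : ∀ {x z a b d : ℕ} → a ≡ x ⊎ a ≡ z → b ≡ x ⊎ b ≡ z → d ≡ x ⊎ d ≡ z →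
      a ≢ b → a ≢ d → b ≡ d
    pair-pigeonhole (inj₁ refl) (inj₁ refl) _           a≢b _   = ⊥-elim (a≢b refl)
    pair-pigeonhole (inj₂ refl) (inj₂ refl) _           a≢b _   = ⊥-elim (a≢b refl)
    pair-pigeonhole (inj₁ refl) _           (inj₁ refl) _   a≢d = ⊥-elim (a≢d refl)
    pair-pigeonhole (inj₂ refl) _           (inj₂ refl) _   a≢d = ⊥-elim (a≢d refl)
    pair-pigeonhole (inj₁ refl) (inj₂ refl) (inj₂ refl) _   _   = refl
    pair-pigeonhole (inj₂ refl) (inj₁ refl) (inj₁ refl) _   _   = refl

  next-vertex-unique : ∀ {x z} {u t w w′ : Vertex} e₁ e₂ e₃ →
    Joins e₁ u t → Joins e₂ u w → Joins e₃ u w′ →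
    InColours x z e₁ → InColours x z e₂ → InColours x z e₃ → t ≢ w → t ≢ w′ → w ≡ w′
  next-vertex-unique e₁ e₂ e₃ j₁ j₂ j₃ c₁ c₂ c₃ t≢w t≢w′ =
    same-colour-Joins e₂ e₃ (pair-pigeonhole c₁ c₂ c₃
      (λ eq → t≢w (same-colour-Joins e₁ e₂ eq j₁ j₂))
      (λ eq → t≢w′ (same-colour-Joins e₁ e₃ eq j₁ j₃))) j₂ j₃

  NonBacktrackingWalk : ℕ → ℕ → (ℕ → Vertex) → Set
  NonBacktrackingWalk x z W =
    ∀ k → (∃ λ e → Joins e (W k) (W (suc k)) × InColours x z e) × W (suc (suc k)) ≢ W k

  walk-unique : ∀ {x z} {A B : ℕ → Vertex} → NonBacktrackingWalk x z A → NonBacktrackingWalk x z B →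
    A 0 ≡ B 0 → A 1 ≡ B 1 → ∀ k → A k ≡ B k
  walk-unique {A = A} {B} walkA walkB A₀≡ A₁≡ k = proj₁ (agree k)
    where
    agree : ∀ k → A k ≡ B k × A (suc k) ≡ B (suc k)
    agree zero = A₀≡ , A₁≡
    agree (suc k) with agree k | walkA k | walkB k | walkA (suc k) | walkB (suc k)
    ... | Aₖ≡ , Aₖ₊₁≡ | _ , backA | (e , j , ce) , backB
        | (ea , ja , ca) , _ | (eb , jb , cb) , _ =
      Aₖ₊₁≡ , next-vertex-unique e ea eb (Joins-sym e j)
                (subst (λ u → Joins ea u (A (suc (suc k)))) Aₖ₊₁≡ ja) jb ce ca cb
                (λ q → backA (trans (sym q) (sym Aₖ≡))) (λ q → backB (sym q))

-- The mate map determined by the 1-factor Y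

module Mate {K : ℕ} (3≤K : 3 ≤ K) (c : Colouring (suc K)) (fac : IsOneFactorisation c)
  (y : ℕ) (y-used : Used c y)
  (Y-config : ∀ (e : Edge (suc K)) → c e ≡ y → (kind e ≡ one) × IsKConfiguration c 2 (base e)) where

  open OneFactorisation (≤-trans (n≤1+n 2) 3≤K) c fac

  private
    Vertex : Set
    Vertex = Fin (suc K)

    1≤K : 1 ≤ K
    1≤K = ≤-trans (s≤s z≤n) 3≤K

  InY : Vertex → Set
  InY a = c (a , one) ≡ y

  Y-covers : ∀ v → InY (predMod v) ⊎ InY v
  Y-covers v with fac y y-used v
  ... | (a , k) , ca , inc , _ with Y-config (a , k) ca
  Y-covers v | (a , one) , ca , inj₁ refl , _ | _ = inj₂ ca
  Y-covers v | (a , one) , ca , inj₂ refl , _ | _ = inj₁ (subst InY (sym (predMod-sucMod a)) ca)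
  Y-covers v | (a , two) , _  , _         , _ | () , _

  Y-not-both : ∀ v → InY (predMod v) → ¬ InY v
  Y-not-both v left here = predMod-≢ 1≤K v (cong proj₁
    (same-colour-at (predMod v , one) (v , one) (trans left (sym here))
      (inj₂ (sym (sucMod-predMod v))) (inj₁ refl)))

  Y-next : ∀ v → InY v → ¬ InY (sucMod v)
  Y-next v here = Y-not-both (sucMod v) (subst InY (sym (predMod-sucMod v)) here)

  ¬Y-next : ∀ v → ¬ InY v → InY (sucMod v)
  ¬Y-next v ¬here = [ (λ left → ⊥-elim (¬here (subst InY (predMod-sucMod v) left))) , id ]′
                      (Y-covers (sucMod v))

  twoEdge-∉Y : ∀ a → c (a , two) ≢ y
  twoEdge-∉Y a eq with Y-config (a , two) eq
  ... | () , _

  -- In the 2-configuration of a Y-edge neither 2-edge has colour y, so they share a colour.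
  Y-twoEdges : ∀ a → InY a → c (predMod a , two) ≡ c (a , two)
  Y-twoEdges a here = distinct3≡2⇒a≡d _ _ _ (proj₂ (Y-config (a , one) here))
    (λ eq → twoEdge-∉Y (predMod a) (trans eq here)) (λ eq → twoEdge-∉Y a (trans eq here))

  mate : Vertex → Vertex
  mate v with c (predMod v , one) ≟ y
  ... | yes _ = sucMod v
  ... | no  _ = predMod v

  mate-suc : ∀ v → InY (predMod v) → mate v ≡ sucMod v
  mate-suc v left with c (predMod v , one) ≟ y
  ... | yes _     = refl
  ... | no ¬left  = ⊥-elim (¬left left)

  mate-pred : ∀ v → ¬ InY (predMod v) → mate v ≡ predMod v
  mate-pred v ¬left with c (predMod v , one) ≟ y
  ... | yes left = ⊥-elim (¬left left)
  ... | no _     = refl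

  mate-suc-or-pred : ∀ v → mate v ≡ sucMod v ⊎ mate v ≡ predMod v
  mate-suc-or-pred v with c (predMod v , one) ≟ y
  ... | yes _ = inj₁ refl
  ... | no  _ = inj₂ refl

  mate-involutive : ∀ v → mate (mate v) ≡ v
  mate-involutive v with Y-covers v
  ... | inj₁ left = begin
    mate (mate v)            ≡⟨ cong mate (mate-suc v left) ⟩
    mate (sucMod v)          ≡⟨ mate-pred _ (Y-not-both v left ∘ subst InY (predMod-sucMod v)) ⟩
    predMod (sucMod v)       ≡⟨ predMod-sucMod v ⟩
    v                        ∎
  ... | inj₂ here = begin
    mate (mate v)            ≡⟨ cong mate (mate-pred v ¬left) ⟩
    mate (predMod v)         ≡⟨ mate-suc (predMod v) left² ⟩
    sucMod (predMod v)       ≡⟨ sucMod-predMod v ⟩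
    v                        ∎
    where
    ¬left : ¬ InY (predMod v)
    ¬left left = Y-not-both v left here
    left² : InY (predMod (predMod v))
    left² = [ id , (λ left → ⊥-elim (¬left left)) ]′ (Y-covers (predMod v))

  mate-injective : ∀ {u v} → mate u ≡ mate v → u ≡ v
  mate-injective {u} {v} eq = begin
    u              ≡⟨ mate-involutive u ⟨
    mate (mate u)  ≡⟨ cong mate eq ⟩
    mate (mate v)  ≡⟨ mate-involutive v ⟩
    v              ∎

  mate-≢ : ∀ v → mate v ≢ v
  mate-≢ v with mate-suc-or-pred v
  ... | inj₁ m≡s = sucMod-≢ 1≤K v ∘ trans (sym m≡s)
  ... | inj₂ m≡p = predMod-≢ 1≤K v ∘ trans (sym m≡p)

  oneEdge-joins-mate : ∀ e {u w} → Joins e u w → kind e ≡ one → c e ≢ y → w ≡ mate u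
  oneEdge-joins-mate (a , one) (inj₁ (refl , refl)) _ ¬here with Y-covers a
  ... | inj₁ left = sym (mate-suc a left)
  ... | inj₂ here = ⊥-elim (¬here here)
  oneEdge-joins-mate (a , one) (inj₂ (refl , refl)) _ ¬here = sym (begin
    mate (sucMod a)     ≡⟨ mate-pred (sucMod a) (¬here ∘ subst InY (predMod-sucMod a)) ⟩
    predMod (sucMod a)  ≡⟨ predMod-sucMod a ⟩
    a                   ∎)
  oneEdge-joins-mate (a , two) _ () _

  mate-edge⇒one : ∀ e {u} → Joins e u (mate u) → kind e ≡ one
  mate-edge⇒one (a , one) _ = refl
  mate-edge⇒one (a , two) (inj₁ (refl , m≡)) with mate-suc-or-pred a
  ... | inj₁ m≡s = ⊥-elim (sucMod-≢ 1≤K a (sucMod-injective (trans (sym m≡) m≡s)))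
  ... | inj₂ m≡p =
    ⊥-elim (sucMod³-≢ 3≤K a (trans (cong sucMod (trans (sym m≡) m≡p)) (sucMod-predMod a)))
  mate-edge⇒one (a , two) (inj₂ (m≡ , refl)) with mate-suc-or-pred (sucMod (sucMod a))
  ... | inj₁ m≡s = ⊥-elim (sucMod³-≢ 3≤K a (trans (sym m≡s) m≡))
  ... | inj₂ m≡p =
    ⊥-elim (sucMod-≢ 1≤K a (trans (sym (predMod-sucMod (sucMod a))) (trans (sym m≡p) m≡)))

  private
    mate-twoEdge : ∀ a → ∃ λ e → Joins e (mate a) (mate (sucMod (sucMod a))) × c e ≡ c (a , two)
    mate-twoEdge a with Y-covers a
    ... | inj₁ left =
      (sucMod a , two) , inj₁ (mate-suc a left , mate-suc (sucMod (sucMod a)) left″) ,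
      trans (sym (Y-twoEdges (sucMod a) right)) (cong (λ t → c (t , two)) (predMod-sucMod a))
      where
      right : InY (sucMod a)
      right = ¬Y-next a (Y-not-both a left)
      left″ : InY (predMod (sucMod (sucMod a)))
      left″ = subst InY (sym (predMod-sucMod (sucMod a))) right
    ... | inj₂ here = (predMod a , two) , inj₁ (mate-pred a ¬left , mate″) , Y-twoEdges a here
      where
      ¬left : ¬ InY (predMod a)
      ¬left left = Y-not-both a left here
      ¬left″ : ¬ InY (predMod (sucMod (sucMod a)))
      ¬left″ = Y-next a here ∘ subst InY (predMod-sucMod (sucMod a))
      mate″ : mate (sucMod (sucMod a)) ≡ sucMod (sucMod (predMod a))
      mate″ = begin
        mate (sucMod (sucMod a))      ≡⟨ mate-pred _ ¬left″ ⟩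
        predMod (sucMod (sucMod a))   ≡⟨ predMod-sucMod (sucMod a) ⟩
        sucMod a                      ≡⟨ cong sucMod (sucMod-predMod a) ⟨
        sucMod (sucMod (predMod a))   ∎

  mate-preserves-edge : ∀ e {u w} → Joins e u w → c e ≢ y →
    ∃ λ e′ → Joins e′ (mate u) (mate w) × c e′ ≡ c e
  mate-preserves-edge (a , one) {u} {w} j ¬here =
    (a , one) , subst₂ (Joins (a , one)) w≡ u≡ (Joins-sym (a , one) j) , refl
    where
    w≡ : w ≡ mate u
    w≡ = oneEdge-joins-mate (a , one) j refl ¬here
    u≡ : u ≡ mate w
    u≡ = trans (sym (mate-involutive u)) (cong mate (sym w≡))
  mate-preserves-edge (a , two) (inj₁ (refl , refl)) _ = mate-twoEdge a
  mate-preserves-edge (a , two) (inj₂ (refl , refl)) _ with mate-twoEdge a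
  ... | e′ , j , ce′ = e′ , Joins-sym e′ j , ce′

-- A cycle of X ∪ Z, its vertices indexed periodically by ℕ

module MateCycle {K : ℕ} (3≤K : 3 ≤ K) (c : Colouring (suc K)) (fac : IsOneFactorisation c)
  (y : ℕ) (y-used : Used c y)
  (Y-config : ∀ (e : Edge (suc K)) → c e ≡ y → (kind e ≡ one) × IsKConfiguration c 2 (base e))
  (x z : ℕ) (x≢y : x ≢ y) (z≢y : z ≢ y) (r : ℕ)
  (vs : Fin (3 + r) → Fin (suc K)) (vs-inj : Injective _≡_ _≡_ vs)
  (es : Fin (3 + r) → Edge (suc K))
  (es-joins : ∀ i → Joins (es i) (vs i) (vs (sucMod i)))
  (es-colour : ∀ i → (c (es i) ≡ x) ⊎ (c (es i) ≡ z)) where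

  open OneFactorisation (≤-trans (n≤1+n 2) 3≤K) c fac
  open Mate 3≤K c fac y y-used Y-config

  M : ℕ
  M = 3 + r

  V : ℕ → Fin (suc K)
  V k = vs (k mod M)

  toℕ-mod-% : ∀ k → toℕ (k mod M) % M ≡ k % M
  toℕ-mod-% k = trans (cong (_% M) (toℕ-fromℕ< (m%n<n k M))) (m%n%n≡m%n k M)

  V-cong : ∀ a b → a % M ≡ b % M → V a ≡ V b
  V-cong a b eq =
    cong vs (toℕ-injective (trans (toℕ-fromℕ< _) (trans eq (sym (toℕ-fromℕ< _)))))

  V⇒% : ∀ a b → V a ≡ V b → a % M ≡ b % M
  V⇒% a b eq = trans (sym (toℕ-fromℕ< _)) (trans (cong toℕ (vs-inj eq)) (toℕ-fromℕ< _))

  V-toℕ : ∀ j → V (toℕ j) ≡ vs j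
  V-toℕ j = cong vs (toℕ-injective (trans (toℕ-fromℕ< _) (m<n⇒m%n≡m (toℕ<n j))))

  V-+M : ∀ a → V (a + M) ≡ V a
  V-+M a = V-cong (a + M) a ([m+n]%n≡m%n a M)

  V-+*M : ∀ a q → V (a + q * M) ≡ V a
  V-+*M a q = V-cong (a + q * M) a ([m+kn]%n≡m%n a q M)

  V-shift-≢ : ∀ a {d} → 0 < d → d < M → V (d + a) ≢ V a
  V-shift-≢ a {d} 0<d d<M = [m+n]%o≢n%o a 0<d d<M ∘ V⇒% (d + a) a

  V-window-injective : ∀ i {a b} → a < M → b < M → V (i + a) ≡ V (i + b) → a ≡ b
  V-window-injective i {a} {b} a<M b<M = [i+m]%o≡[i+n]%o⇒m≡n i a<M b<M ∘ V⇒% (i + a) (i + b)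

  V-step : ∀ k → Joins (es (k mod M)) (V k) (V (suc k))
  V-step k = subst (Joins (es (k mod M)) (V k)) V-suc (es-joins (k mod M))
    where
    V-suc : V (suc (toℕ (k mod M))) ≡ V (suc k)
    V-suc = V-cong (suc (toℕ (k mod M))) (suc k) (suc-%-cong (toℕ (k mod M)) k (toℕ-mod-% k))

  InColours⇒≢y : ∀ {e} → InColours x z e → c e ≢ y
  InColours⇒≢y (inj₁ ce≡x) ce≡y = x≢y (trans (sym ce≡x) ce≡y)
  InColours⇒≢y (inj₂ ce≡z) ce≡y = z≢y (trans (sym ce≡z) ce≡y)

  MateEdgeAt : ℕ → Set
  MateEdgeAt k = V (suc k) ≡ mate (V k)

  MateEdgeAt-cong : ∀ a b → a % M ≡ b % M → MateEdgeAt a → MateEdgeAt b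
  MateEdgeAt-cong a b eq mate-edge = begin
    V (suc b)    ≡⟨ V-cong (suc b) (suc a) (suc-%-cong b a (sym eq)) ⟩
    V (suc a)    ≡⟨ mate-edge ⟩
    mate (V a)   ≡⟨ cong mate (V-cong a b eq) ⟩
    mate (V b)   ∎

  OneAt : Fin M → Set
  OneAt j = isOne (kind (es j))

  OneAt? : Decidable OneAt
  OneAt? j = isOne? (kind (es j))

  OneAt⇒MateEdgeAt : ∀ j → OneAt j → MateEdgeAt (toℕ j)
  OneAt⇒MateEdgeAt j one-j = begin
    V (suc (toℕ j))    ≡⟨ oneEdge-joins-mate (es j) (es-joins j) (isOne⇒≡one one-j) ¬y ⟩
    mate (vs j)        ≡⟨ cong mate (V-toℕ j) ⟨
    mate (V (toℕ j))   ∎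
    where
    ¬y : c (es j) ≢ y
    ¬y = InColours⇒≢y (es-colour j)

  MateEdgeAt⇒OneAt : ∀ j → MateEdgeAt (toℕ j) → OneAt j
  MateEdgeAt⇒OneAt j mate-edge = ≡one⇒isOne (mate-edge⇒one (es j)
    (subst (Joins (es j) (vs j)) (trans mate-edge (cong mate (V-toℕ j))) (es-joins j)))

  forward-walk : ∀ i → NonBacktrackingWalk x z (λ k → V (i + k))
  forward-walk i k =
    (e , subst (Joins e (V (i + k)) ∘ V) (sym (+-suc i k)) (V-step (i + k)) , es-colour ((i + k) mod M)) ,
    (λ back → V-shift-≢ (i + k) z<s (s≤s (s≤s (s≤s z≤n))) (trans (cong V shift²) back))
    where
    e : Edge (suc K)
    e = es ((i + k) mod M)
    shift² : 2 + (i + k) ≡ i + suc (suc k)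
    shift² = sym (trans (+-suc i (suc k)) (cong suc (+-suc i k)))

  module Reflection (i : ℕ) (mate-edge : MateEdgeAt i) where

    -- backward k ≡ i + 1 − k (mod M)
    backward : ℕ → ℕ
    backward k = suc i + k * (2 + r)

    backward-walk : NonBacktrackingWalk x z (λ k → mate (V (backward k)))
    backward-walk k = edge , back
      where
      e : Edge (suc K)
      e = es ((backward k + (2 + r)) mod M)

      step : Joins e (V (backward (suc k))) (V (backward k))
      step = subst₂ (Joins e) (cong V (sym (backward-suc k)))
               (trans (cong V (sym (+-suc (backward k) (2 + r)))) (V-+M (backward k)))
               (V-step (backward k + (2 + r)))
        where
        backward-suc : ∀ k → backward (suc k) ≡ backward k + (2 + r)
        backward-suc k = trans (cong (suc i +_) (+-comm (2 + r) (k * (2 + r))))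
                               (sym (+-assoc (suc i) (k * (2 + r)) (2 + r)))

      edge : ∃ λ e → Joins e (mate (V (backward k))) (mate (V (backward (suc k)))) × InColours x z e
      edge with mate-preserves-edge e (Joins-sym e step) (InColours⇒≢y (es-colour _))
      ... | e′ , j′ , ce′ = e′ , j′ , Sum.map (trans ce′) (trans ce′) (es-colour _)

      back : mate (V (backward (2 + k))) ≢ mate (V (backward k))
      back eq = V-shift-≢ (backward k) z<s (s≤s (s≤s (n≤1+n r)))
        (trans (sym (trans (cong V (wrap i k r)) (V-+*M (suc r + backward k) 1))) (mate-injective eq))
        where
        wrap : ∀ i k r → suc i + (2 + k) * (2 + r) ≡ (suc r + (suc i + k * (2 + r))) + 1 * (3 + r)
        wrap = solve-∀

    backward-reflects : ∀ k → mate (V (backward k)) ≡ V (i + k)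
    backward-reflects = walk-unique backward-walk (forward-walk i) start₀ start₁
      where
      start₀ : mate (V (backward 0)) ≡ V (i + 0)
      start₀ = begin
        mate (V (suc i + 0))  ≡⟨ cong (mate ∘ V) (+-identityʳ (suc i)) ⟩
        mate (V (suc i))      ≡⟨ cong mate mate-edge ⟩
        mate (mate (V i))     ≡⟨ mate-involutive (V i) ⟩
        V i                   ≡⟨ cong V (+-identityʳ i) ⟨
        V (i + 0)             ∎
      start₁ : mate (V (backward 1)) ≡ V (i + 1)
      start₁ = begin
        mate (V (suc i + 1 * (2 + r)))  ≡⟨ cong (mate ∘ V) (once i r) ⟩
        mate (V (i + M))                ≡⟨ cong mate (V-+M i) ⟩
        mate (V i)                      ≡⟨ mate-edge ⟨
        V (suc i)                       ≡⟨ cong V (+-comm 1 i) ⟩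
        V (i + 1)                       ∎
        where
        once : ∀ i r → suc i + 1 * (2 + r) ≡ i + (3 + r)
        once = solve-∀

    reflection : ∀ j t → suc (j + t) ≡ M → mate (V (i + suc t)) ≡ V (i + suc j)
    reflection j t M≡ = begin
      mate (V (i + suc t))                    ≡⟨ cong mate (V-+*M (i + suc t) j) ⟨
      mate (V (i + suc t + j * M))            ≡⟨ cong (λ m → mate (V (i + suc t + j * m))) M≡ ⟨
      mate (V (i + suc t + j * suc (j + t)))  ≡⟨ cong (mate ∘ V) (reindex i j t) ⟨
      mate (V (suc i + suc j * (j + t)))      ≡⟨ cong (λ m → mate (V (suc i + suc j * m)))
                                                       (suc-injective M≡) ⟩
      mate (V (backward (suc j)))             ≡⟨ backward-reflects (suc j) ⟩
      V (i + suc j)                           ∎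
      where
      reindex : ∀ i j t → suc i + suc j * (j + t) ≡ i + suc t + j * suc (j + t)
      reindex = solve-∀

    M-not-odd : ∀ h → M ≢ suc (h + h)
    M-not-odd h M≡ = mate-≢ _ (reflection h h (sym M≡))

    opposite-mateEdge : ∀ h → M ≡ h + h → MateEdgeAt (i + h)
    opposite-mateEdge zero    ()
    opposite-mateEdge (suc h) M≡ = begin
      V (suc (i + suc h))   ≡⟨ cong V (+-suc i (suc h)) ⟨
      V (i + suc (suc h))   ≡⟨ reflection (suc h) h (sym (trans M≡ (+-suc (suc h) h))) ⟨
      mate (V (i + suc h))  ∎

    mateEdge-offsets : ∀ k → k < M → MateEdgeAt (i + k) → k ≡ 0 ⊎ M ≡ k + k
    mateEdge-offsets zero    _   _         = inj₁ refl
    mateEdge-offsets (suc k) k<M mate-edge = inj₂ (begin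
      M                  ≡⟨ M≡ ⟨
      suc (suc k + t)    ≡⟨ +-suc (suc k) t ⟨
      suc k + suc t      ≡⟨ cong (suc k +_) t≡k ⟩
      suc k + suc k      ∎)
      where
      t : ℕ
      t = M ∸ suc (suc k)
      M≡ : suc (suc k + t) ≡ M
      M≡ = m+[n∸m]≡n k<M
      t<M : suc t < M
      t<M = subst (suc t <_) M≡ (s≤s (s≤s (m≤n+m t k)))
      t≡k : suc t ≡ suc k
      t≡k = V-window-injective i t<M k<M (mate-injective (begin
        mate (V (i + suc t))  ≡⟨ reflection (suc k) t M≡ ⟩
        V (i + suc (suc k))   ≡⟨ cong V (+-suc i (suc k)) ⟩
        V (suc (i + suc k))   ≡⟨ mate-edge ⟩
        mate (V (i + suc k))  ∎))

  two-one-edges : ∀ i → OneAt i → count OneAt? ≡ 2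
  two-one-edges i one-i = byParity (even⊎odd M)
    where
    open Reflection (toℕ i) (OneAt⇒MateEdgeAt i one-i)

    vs-offset : ∀ {k} j → (toℕ i + k) % M ≡ toℕ j % M → vs j ≡ V (toℕ i + k)
    vs-offset {k} j eq = trans (sym (V-toℕ j)) (V-cong (toℕ j) (toℕ i + k) (sym eq))

    vs-i : vs i ≡ V (toℕ i + 0)
    vs-i = vs-offset i (cong (_% M) (+-identityʳ (toℕ i)))

    byParity : (∃ λ h → M ≡ h + h) ⊎ (∃ λ h → M ≡ suc (h + h)) → count OneAt? ≡ 2
    byParity (inj₂ (h , M≡)) = ⊥-elim (M-not-odd h M≡)
    byParity (inj₁ (suc h , M≡)) = count-pair OneAt? one-i one-i′ i≢i′ only
      where
      i′ : Fin M
      i′ = (toℕ i + suc h) mod M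

      one-i′ : OneAt i′
      one-i′ = MateEdgeAt⇒OneAt i′ (MateEdgeAt-cong (toℕ i + suc h) (toℕ i′)
                 (sym (toℕ-mod-% (toℕ i + suc h))) (opposite-mateEdge (suc h) M≡))

      h<M : suc h < M
      h<M = subst (suc h <_) (sym M≡) (m<m+n (suc h) z<s)

      i≢i′ : i ≢ i′
      i≢i′ eq with V-window-injective (toℕ i) z<s h<M (trans (sym vs-i) (cong vs eq))
      ... | ()

      only : ∀ j → OneAt j → j ≡ i ⊎ j ≡ i′
      only j one-j with %-offset (toℕ i) (toℕ j) (<⇒≤ (toℕ<n i))
      ... | k , k<M , k≡
          with mateEdge-offsets k k<M (MateEdgeAt-cong (toℕ j) (toℕ i + k) (sym k≡) (OneAt⇒MateEdgeAt j one-j))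
      ... | inj₁ refl = inj₁ (vs-inj (trans (vs-offset j k≡) (sym vs-i)))
      ... | inj₂ M≡k+k = inj₂ (vs-inj (trans (vs-offset j k≡)
                              (cong (λ t → V (toℕ i + t)) (+-double-injective (trans (sym M≡k+k) M≡)))))

  one-edge-count : count OneAt? ≡ 0 ⊎ count OneAt? ≡ 2
  one-edge-count with any? OneAt?
  ... | no  none        = inj₁ (count-none OneAt? (λ j one-j → none (j , one-j)))
  ... | yes (i , one-i) = inj₂ (two-one-edges i one-i)

mainTheorem20 : (n : ℕ) → 3 ≤ n → 2 ∣ n →
    (c : Colouring (2 * n)) → IsOneFactorisation c →
    (y : ℕ) → Used c y →
    (∀ (e : Edge (2 * n)) → c e ≡ y →
      (kind e ≡ one) × IsKConfiguration c 2 (base e)) →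
    (x z : ℕ) → Used c x → Used c z → x ≢ z → x ≢ y → z ≢ y →
    (C : CycleIn c x z) → (numOneEdges C ≡ 0) ⊎ (numOneEdges C ≡ 2)
mainTheorem20 (suc n) (s≤s 2≤n) _ c fac y y-used Y-config x z _ _ _ x≢y z≢y
  record { m = suc (suc (suc r)) ; m≥3 = s≤s (s≤s (s≤s z≤n)) ; vs = vs ; vs-inj = vs-inj
         ; es = es ; es-joins = es-joins ; es-colour = es-colour } =
  Sum.map (trans counted) (trans counted)
    (MateCycle.one-edge-count 3≤K c fac y y-used Y-config x z x≢y z≢y r vs vs-inj es es-joins es-colour)
  where
  3≤K : 3 ≤ n + suc (n + 0)
  3≤K = +-mono-≤ 2≤n (s≤s z≤n)
  counted : length (filter (λ i → isOne? (kind (es i))) (allFin (3 + r)))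
          ≡ count (λ i → isOne? (kind (es i)))
  counted = length-filter-tabulate (λ i → isOne? (kind (es i))) id
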